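{- Let $G=(V,E)$ be a $3$-regular connected undirected graph and $u\in V$. There is no map $\lambda\colon E\to\mathbb{F}_2$ that solves none of the Tseitin equations for the vertices $v\in V$ (equivalently, with $A$ the set of all maps $E\to\mathbb{F}_2$ and $\Gamma$ the edge-flip group acting on $A$, there is no $\Gamma$-orbit $\Omega_\emptyset\subseteq A$ consisting of the assignments that solve the Tseitin equation of no vertex).
   Context: $E(v)$ denotes the set of edges incident to $v$. The Tseitin equation for $v\in V$ is $\sum_{e\in E(v)}\lambda(e)=0$ in $\mathbb{F}_2$ if $v\neq u$, and $\sum_{e\in E(u)}\lambda(e)=1$ in $\mathbb{F}_2$ for $v=u$. The edge-flip group $\Gamma$ is the subgroup of $(\mathbb{F}_2^E,+)$ of all $\pi$ with $\sum_{e\in E(v)}\pi_e=0$ for every $v$, acting on maps $\lambda\colon E\to\mathbb{F}_2$ by $(\pi\lambda)(e)=\lambda(e)+\pi_e$. -}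

module Defs where

open import Data.Nat using (ℕ; zero; suc; _+_)
open import Data.Fin using (Fin; _≟_)
open import Data.Bool using (Bool; true; false; if_then_else_; _xor_; _∨_)
open import Data.List using (List; []; _∷_; foldr; map; filterᵇ; allFin)
open import Data.Product using (Σ; _×_; _,_; proj₁; proj₂; ∃)
open import Data.Sum using (_⊎_)
open import Relation.Binary.PropositionalEquality using (_≡_; _≢_)
open import Relation.Nullary.Decidable using (⌊_⌋)

record Graph (n m : ℕ) : Set where
  field
    ends     : Fin m → Fin n × Fin n
    loopless : ∀ e → proj₁ (ends e) ≢ proj₂ (ends e)
    simple   : ∀ e f → (ends e ≡ ends f ⊎ ends e ≡ (proj₂ (ends f) , proj₁ (ends f))) → e ≡ f
open Graph public

-- F₂ is modelled by Bool, with addition = xor and 0 = false, 1 = true.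
F₂ : Set
F₂ = Bool

incident : ∀ {n m} → Graph n m → Fin n → Fin m → Bool
incident G v e = ⌊ proj₁ (ends G e) ≟ v ⌋ ∨ ⌊ proj₂ (ends G e) ≟ v ⌋

edgesAt : ∀ {n m} → Graph n m → Fin n → List (Fin m)
edgesAt G v = filterᵇ (incident G v) (allFin _)

degree : ∀ {n m} → Graph n m → Fin n → ℕ
degree G v = foldr (λ _ k → suc k) 0 (edgesAt G v)

ThreeRegular : ∀ {n m} → Graph n m → Set
ThreeRegular G = ∀ v → degree G v ≡ 3

Adj : ∀ {n m} → Graph n m → Fin n → Fin n → Set
Adj G v w = ∃ λ e → ends G e ≡ (v , w) ⊎ ends G e ≡ (w , v)

data Reach {n m} (G : Graph n m) : Fin n → Fin n → Set where
  here : ∀ {v} → Reach G v v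
  step : ∀ {v w x} → Adj G v w → Reach G w x → Reach G v x

Connected : ∀ {n m} → Graph n m → Set
Connected G = ∀ v w → Reach G v w

edgeSum : ∀ {n m} → Graph n m → (Fin m → F₂) → Fin n → F₂
edgeSum G λ' v = foldr _xor_ false (map λ' (edgesAt G v))

-- right-hand side of the Tseitin equation with charge at u
charge : ∀ {n} → Fin n → Fin n → F₂
charge u v = ⌊ v ≟ u ⌋

SolvesTseitinAt : ∀ {n m} → Graph n m → Fin n → (Fin m → F₂) → Fin n → Set
SolvesTseitinAt G u λ' v = edgeSum G λ' v ≡ charge u v

{-# OPTIONS --safe #-}
module Submission where

-- Every vertex has odd degree, so complementing λ adds 1 to the left-hand side of
-- every equation: an assignment violating all equations complements to one solving
-- all of them. But summing all equations counts every edge twice, so the left-hand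
-- sides add up to 0 while the charges add up to 1.

open import Defs
open import Algebra.Bundles using (CommutativeRing)
open import Data.Bool using (Bool; true; false; not; _xor_; _∧_; _∨_)
open import Data.Bool.Properties using (xor-∧-commutativeRing; ∧-distribˡ-xor; ¬-not)
open import Data.Nat using (zero; suc)
open import Data.Fin using (Fin; zero; suc; _≟_)
open import Data.List using (List; []; _∷_; foldr; map; filterᵇ; tabulate; allFin; length)
open import Data.List.Properties using (map-tabulate)
import Data.Vec.Functional as Vector
open import Data.Product using (Σ; _,_; proj₁; proj₂)
open import Function using (_∘_; id)
open import Relation.Binary.PropositionalEquality
  using (_≡_; _≢_; refl; sym; trans; cong; cong₂; module ≡-Reasoning)
open import Relation.Nullary using (¬_; yes; no; contradiction)
open import Relation.Nullary.Decidable using (⌊_⌋; ⌊⌋-map′)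

open CommutativeRing xor-∧-commutativeRing using (semiring; +-rawMonoid)
open import Algebra.Properties.Semiring.Sum semiring
  using (sum; sum-syntax; sum-cong-≗; sum-replicate-zero; ∑-distrib-+; ∑-comm; *-distribʳ-sum)
open import Algebra.Definitions.RawMonoid +-rawMonoid using (_×_)

open ≡-Reasoning

∑-indicatorˡ : ∀ {n} (a : Fin n) → ∑[ v < n ] ⌊ a ≟ v ⌋ ≡ true
∑-indicatorˡ {suc n} zero    = cong (true xor_) (sum-replicate-zero n)
∑-indicatorˡ {suc n} (suc a) = trans (sum-cong-≗ (λ v → ⌊⌋-map′ _ _ (a ≟ v))) (∑-indicatorˡ a)

∑-indicatorʳ : ∀ {n} (a : Fin n) → ∑[ v < n ] ⌊ v ≟ a ⌋ ≡ true
∑-indicatorʳ {suc n} zero    = cong (true xor_) (sum-replicate-zero n)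
∑-indicatorʳ {suc n} (suc a) = trans (sum-cong-≗ (λ v → ⌊⌋-map′ _ _ (v ≟ a))) (∑-indicatorʳ a)

foldr-tabulate : ∀ {A B : Set} (f : A → B → B) (z : B) {n} (g : Fin n → A) →
                 foldr f z (tabulate g) ≡ Vector.foldr f z g
foldr-tabulate f z {zero}  g = refl
foldr-tabulate f z {suc n} g = cong (f (g zero)) (foldr-tabulate f z (g ∘ suc))

foldr-xor-filterᵇ : ∀ {A : Set} (p f : A → Bool) (xs : List A) →
                    foldr _xor_ false (map f (filterᵇ p xs)) ≡ foldr _xor_ false (map (λ x → p x ∧ f x) xs)
foldr-xor-filterᵇ p f []       = refl
foldr-xor-filterᵇ p f (x ∷ xs) with p x
... | true  = cong (f x xor_) (foldr-xor-filterᵇ p f xs)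
... | false = foldr-xor-filterᵇ p f xs

foldr-xor-const : ∀ {A : Set} (b : Bool) (xs : List A) →
                  foldr _xor_ false (map (λ _ → b) xs) ≡ length xs × b
foldr-xor-const b []       = refl
foldr-xor-const b (_ ∷ xs) = cong (b xor_) (foldr-xor-const b xs)

indicator-∨≗xor : ∀ {n} {a b : Fin n} → a ≢ b → ∀ v → ⌊ a ≟ v ⌋ ∨ ⌊ b ≟ v ⌋ ≡ ⌊ a ≟ v ⌋ xor ⌊ b ≟ v ⌋
indicator-∨≗xor {a = a} {b} a≢b v with a ≟ v | b ≟ v
... | yes refl | yes refl = contradiction refl a≢b
... | yes _    | no _     = refl
... | no _     | yes _    = refl
... | no _     | no _     = refl

module _ {n m} (G : Graph n m) where

  edgeSum-∑ : ∀ (lam : Fin m → F₂) v → edgeSum G lam v ≡ ∑[ e < m ] (incident G v e ∧ lam e)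
  edgeSum-∑ lam v = begin
    foldr _xor_ false (map lam (filterᵇ (incident G v) (allFin m)))
      ≡⟨ foldr-xor-filterᵇ (incident G v) lam (tabulate id) ⟩
    foldr _xor_ false (map g (tabulate id))
      ≡⟨ cong (foldr _xor_ false) (map-tabulate id g) ⟩
    foldr _xor_ false (tabulate g)
      ≡⟨ foldr-tabulate _xor_ false g ⟩
    sum g ∎
    where
    g : Fin m → F₂
    g e = incident G v e ∧ lam e

  ∑-incident : ∀ e → ∑[ v < n ] incident G v e ≡ false
  ∑-incident e = begin
    ∑[ v < n ] incident G v e
      ≡⟨ sum-cong-≗ (indicator-∨≗xor (loopless G e)) ⟩
    ∑[ v < n ] (⌊ a ≟ v ⌋ xor ⌊ b ≟ v ⌋)
      ≡⟨ ∑-distrib-+ (λ v → ⌊ a ≟ v ⌋) (λ v → ⌊ b ≟ v ⌋) ⟩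
    ∑[ v < n ] ⌊ a ≟ v ⌋ xor ∑[ v < n ] ⌊ b ≟ v ⌋
      ≡⟨ cong₂ _xor_ (∑-indicatorˡ a) (∑-indicatorˡ b) ⟩
    false ∎
    where
    a = proj₁ (ends G e)
    b = proj₂ (ends G e)

  ∑-edgeSum : ∀ (lam : Fin m → F₂) → ∑[ v < n ] edgeSum G lam v ≡ false
  ∑-edgeSum lam = begin
    ∑[ v < n ] edgeSum G lam v
      ≡⟨ sum-cong-≗ (edgeSum-∑ lam) ⟩
    ∑[ v < n ] ∑[ e < m ] (incident G v e ∧ lam e)
      ≡⟨ ∑-comm (λ v e → incident G v e ∧ lam e) ⟩
    ∑[ e < m ] ∑[ v < n ] (incident G v e ∧ lam e)
      ≡⟨ sum-cong-≗ (λ e → sym (*-distribʳ-sum (lam e) (λ v → incident G v e))) ⟩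
    ∑[ e < m ] (∑[ v < n ] incident G v e ∧ lam e)
      ≡⟨ sum-cong-≗ (λ e → cong (_∧ lam e) (∑-incident e)) ⟩
    ∑[ e < m ] false
      ≡⟨ sum-replicate-zero m ⟩
    false ∎

  edgeSum-xor : ∀ (f g : Fin m → F₂) v → edgeSum G (λ e → f e xor g e) v ≡ edgeSum G f v xor edgeSum G g v
  edgeSum-xor f g v = begin
    edgeSum G (λ e → f e xor g e) v
      ≡⟨ edgeSum-∑ (λ e → f e xor g e) v ⟩
    ∑[ e < m ] (incident G v e ∧ (f e xor g e))
      ≡⟨ sum-cong-≗ (λ e → ∧-distribˡ-xor (incident G v e) (f e) (g e)) ⟩
    ∑[ e < m ] ((incident G v e ∧ f e) xor (incident G v e ∧ g e))
      ≡⟨ ∑-distrib-+ (λ e → incident G v e ∧ f e) (λ e → incident G v e ∧ g e) ⟩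
    ∑[ e < m ] (incident G v e ∧ f e) xor ∑[ e < m ] (incident G v e ∧ g e)
      ≡⟨ sym (cong₂ _xor_ (edgeSum-∑ f v) (edgeSum-∑ g v)) ⟩
    edgeSum G f v xor edgeSum G g v ∎

  edgeSum-ones : ∀ v → edgeSum G (λ _ → true) v ≡ degree G v × true
  edgeSum-ones v = foldr-xor-const true (edgesAt G v)

  tseitin-unsatisfiable : ∀ u (lam : Fin m → F₂) → ¬ (∀ v → SolvesTseitinAt G u lam v)
  tseitin-unsatisfiable u lam solves = contradiction true≡false λ ()
    where
    true≡false : true ≡ false
    true≡false = begin
      true                       ≡⟨ sym (∑-indicatorʳ u) ⟩
      ∑[ v < n ] charge u v      ≡⟨ sym (sum-cong-≗ solves) ⟩
      ∑[ v < n ] edgeSum G lam v ≡⟨ ∑-edgeSum lam ⟩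
      false                      ∎

lemmaC7 : ∀ {n m} (G : Graph n m) → ThreeRegular G → Connected G → (u : Fin n) →
    ¬ (Σ (Fin m → F₂) λ lam → ∀ v → ¬ SolvesTseitinAt G u lam v)
lemmaC7 G regular _ u (lam , fails) = tseitin-unsatisfiable G u (λ e → true xor lam e) solves
  where
  solves : ∀ v → SolvesTseitinAt G u (λ e → true xor lam e) v
  solves v = begin
    edgeSum G (λ e → true xor lam e) v           ≡⟨ edgeSum-xor G (λ _ → true) lam v ⟩
    edgeSum G (λ _ → true) v xor edgeSum G lam v ≡⟨ cong (_xor edgeSum G lam v) (edgeSum-ones G v) ⟩
    degree G v × true xor edgeSum G lam v        ≡⟨ cong (λ d → d × true xor edgeSum G lam v) (regular v) ⟩
    not (edgeSum G lam v)                        ≡⟨ sym (¬-not (fails v ∘ sym)) ⟩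
    charge u v                                   ∎
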